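{- Let $n\ge1$ and $\sigma\in S_n$. Then $H(\sigma)=\sigma$ if and only if $\sigma$ is a strong fixed point of Foata's map, i.e. $\phi_k(\sigma)=\sigma$ for all $1\le k\le n$.
   Context: $S_n$ is the set of permutations of $[n]$ in one-line notation. Han's map: for $x\in[n]$ and a permutation $\sigma=\sigma_1\cdots\sigma_{n-1}$ of $[n]\setminus\{x\}$, let $C^x(\sigma)=\tau_1\cdots\tau_{n-1}\in S_{n-1}$ with $\tau_i=\sigma_i-x+n$ if $\sigma_i<x$ and $\tau_i=\sigma_i-x$ if $\sigma_i>x$, and $C_x(\sigma)=\nu_1\cdots\nu_{n-1}\in S_{n-1}$ with $\nu_i=\sigma_i$ if $\sigma_i<x$, $\nu_i=\sigma_i-1$ if $\sigma_i>x$. Then $H(1)=1$ and for $n>1$, $H(\sigma)=C_{\sigma_n}^{ -1}\big(H(C^{\sigma_n}(\sigma_1\cdots\sigma_{n-1}))\big)\cdot\sigma_n$. Foata's operator $\gamma_x$: for a word $w=w_1\cdots w_m$ of distinct integers and an integer $x$, if $w_m\le x$ write $w=v_1b_1v_2b_2\cdots v_pb_p$ where each $b_i\le x$ and all letters of each (possibly empty) factor $v_i$ are $>x$; if $w_m>x$ write $w=v_1b_1\cdots v_pb_p$ where each $b_i>x$ and all letters of each $v_i$ are $\le x$; in either case $\gamma_x(w)=b_1v_1b_2v_2\cdots b_pv_p$. The partial Foata maps $\phi_k\colon S_n\to S_n$ ($1\le k\le n$) are $\phi_1(\sigma)=\sigma$ and, for $k>1$, $\phi_k(\sigma)=\gamma_{\sigma_k}(\sigma_1\cdots\sigma_{k-1})\cdot\sigma_k\sigma_{k+1}\cdots\sigma_n$.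 A permutation $\sigma$ is a strong fixed point of Foata's map if $\phi_k(\sigma)=\sigma$ for all $1\le k\le n$. -}

module Defs where

open import Data.Nat using (ℕ; zero; suc; _+_; _∸_; _<ᵇ_; _≤ᵇ_)
open import Data.Bool using (Bool; true; false; if_then_else_; not)
open import Data.List using (List; []; _∷_; _++_; map; reverse; length; take; drop; upTo; [_])
open import Data.List.Relation.Binary.Permutation.Propositional using (_↭_)

range : ℕ → List ℕ
range n = map suc (upTo n)

-- σ ∈ S_n in one-line notation
IsPerm : ℕ → List ℕ → Set
IsPerm n σ = σ ↭ range n

-- letterwise C^x, where n is the size of the ambient set [n]
--   τ = σ - x + n if σ < x,  τ = σ - x if σ > x
Cup : ℕ → ℕ → ℕ → ℕ
Cup n x s = if s <ᵇ x then s + n ∸ x else s ∸ x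

Cdown : ℕ → ℕ → ℕ
Cdown x s = if s <ᵇ x then s else s ∸ 1

-- letterwise inverse of C_x (from [n-1] to [n] \ {x})
CdownInv : ℕ → ℕ → ℕ
CdownInv x t = if t <ᵇ x then t else suc t

-- Han's map on the reversed word  σ_n σ_{n-1} … σ_1, with fuel (≥ length)
Hrev : ℕ → List ℕ → List ℕ
Hrev zero    r       = r
Hrev (suc f) []      = []
Hrev (suc f) (x ∷ r) =
  x ∷ map (CdownInv x) (Hrev f (map (Cup (suc (length r)) x) r))

-- H(σ) = C_{σ_n}^{-1}(H(C^{σ_n}(σ_1⋯σ_{n-1}))) · σ_n ,  H(1) = 1
H : List ℕ → List ℕ
H σ = reverse (Hrev (length σ) (reverse σ))

-- scan a word into factors v b (b satisfying p, letters of v not); emit b v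
γscan : (ℕ → Bool) → List ℕ → List ℕ → List ℕ
γscan p v []      = v
γscan p v (a ∷ w) = if p a then a ∷ v ++ γscan p [] w else γscan p (v ++ [ a ]) w

lastOr : ℕ → List ℕ → ℕ
lastOr d []      = d
lastOr d (a ∷ w) = lastOr a w

γ : ℕ → List ℕ → List ℕ
γ x []        = []
γ x w@(a ∷ _) =
  if lastOr a w ≤ᵇ x then γscan (λ b → b ≤ᵇ x) [] w
                      else γscan (λ b → not (b ≤ᵇ x)) [] w

-- φ_k(σ) = γ_{σ_k}(σ_1⋯σ_{k-1}) · σ_k ⋯ σ_n  (φ_1 = id since γ of empty word is empty)
φ : ℕ → List ℕ → List ℕ
φ zero    σ = σ
φ (suc j) σ with drop j σ
... | []     = σ
... | y ∷ ys = γ y (take j σ) ++ y ∷ ys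

StrongFoataFixed : ℕ → List ℕ → Set
StrongFoataFixed n σ = ∀ k → 1 Data.Nat.≤ k → k Data.Nat.≤ n → φ k σ ≡ σ
  where open import Relation.Binary.PropositionalEquality using (_≡_)

-- Both sides say that every letter of σ is a record (a maximum or a minimum)
-- of the prefix ending in it.  For Foata's map this is immediate: γ_y fixes a
-- word exactly when all its letters lie on one side of y.  For Han's map, H
-- can only fix σ when σ_n is 1 or n, since otherwise C^{σ_n} followed by
-- C_{σ_n}^{-1} visibly moves σ_{n-1}; when σ_n ∈ {1, n} the two conjugations
-- cancel, and one concludes by induction on n.
module Submission where

open import Defs
open import Data.Bool using (Bool; true; false; not; T)
open import Data.Bool.Properties using (T-≡; T-not-≡)
open import Data.Empty using (⊥-elim)
open import Data.Unit using (⊤; tt)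
open import Data.Nat using (ℕ; zero; suc; _+_; _∸_; _≤_; _<_; _<ᵇ_; _≤ᵇ_; z≤n; s≤s; z<s)
open import Data.Nat.Properties
open import Data.Product using (_×_; _,_; proj₁; proj₂; ∃-syntax)
open import Data.Sum using (_⊎_; inj₁; inj₂)
import Data.Sum as Sum
open import Data.List using (List; []; _∷_; _++_; map; reverse; length; take; drop; [_]; upTo)
open import Data.List.Properties
  using (∷-injectiveˡ; ∷-injectiveʳ; ++-assoc; ++-cancelʳ; length-++; length-map; length-upTo;
         map-upTo; upTo-∷ʳ; map-++; map-∘; map-id; map-id-local; map-cong-local; map-injective;
         take++drop≡id; reverse-++; unfold-reverse; reverse-involutive)
open import Data.List.Relation.Unary.All as All using (All; []; _∷_)
import Data.List.Relation.Unary.All.Properties as All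
open import Data.List.Relation.Unary.Any using (Any; here; there)
open import Data.List.Membership.Propositional using (_∈_)
open import Data.List.Membership.Propositional.Properties using (∈-map⁺; ∈-map⁻; ∈-upTo⁺; ∈-upTo⁻)
open import Data.List.Relation.Binary.Permutation.Propositional using (_↭_; ↭-sym; ↭-trans)
open import Data.List.Relation.Binary.Permutation.Propositional.Properties
  using (All-resp-↭; ∈-resp-↭; ↭-reverse; ↭-length; ↭-empty-inv; ¬x∷xs↭[]; drop-∷; ↭-map-inv; ++-comm)
open import Function using (_∘_)
open import Function.Bundles using (Equivalence; _⇔_; mk⇔)
open import Function.Definitions using (Injective)
open import Function.Related.Propositional using (module EquationalReasoning)
open import Relation.Binary.PropositionalEquality using (_≡_; _≢_; refl; sym; trans; cong; subst; module ≡-Reasoning)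
open import Relation.Nullary using (¬_; contradiction)
open import Relation.Nullary.Decidable using (yes; no)
open import Relation.Nullary.Reflects using (ofʸ; ofⁿ)

open Equivalence using (to; from)

OneSided : ℕ → List ℕ → Set
OneSided x w = All (_≤ x) w ⊎ All (x <_) w

OneSided-resp-↭ : ∀ {x u v} → u ↭ v → OneSided x u → OneSided x v
OneSided-resp-↭ u↭v = Sum.map (All-resp-↭ u↭v) (All-resp-↭ u↭v)

lastOr-any : ∀ {P : ℕ → Set} d w → P (lastOr d w) → Any P (d ∷ w)
lastOr-any d []      Pd = here Pd
lastOr-any d (a ∷ w) Pl = there (lastOr-any a w Pl)

lastOr-all : ∀ {P : ℕ → Set} d w → All P (d ∷ w) → P (lastOr d w)
lastOr-all d []      (Pd ∷ []) = Pd
lastOr-all d (a ∷ w) (_ ∷ Pw)  = lastOr-all a w Pw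

T-not-≤ᵇ⇔> : ∀ b x → T (not (b ≤ᵇ x)) ⇔ x < b
T-not-≤ᵇ⇔> b x with b ≤ᵇ x | ≤ᵇ-reflects-≤ b x
... | true  | ofʸ b≤x = mk⇔ (λ ()) (λ x<b → contradiction b≤x (<⇒≱ x<b))
... | false | ofⁿ b≰x = mk⇔ (λ _ → ≰⇒> b≰x) (λ _ → tt)

module _ (p : ℕ → Bool) where

  γscan-all : ∀ w → All (T ∘ p) w → γscan p [] w ≡ w
  γscan-all []      []        = refl
  γscan-all (a ∷ w) (pa ∷ pw) with p a
  ... | true  = cong (a ∷_) (γscan-all w pw)
  ... | false = ⊥-elim pa

  γscan-head : ∀ v w → Any (T ∘ p) w → ∃[ b ] ∃[ u ] T (p b) × γscan p v w ≡ b ∷ u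
  γscan-head v (a ∷ w) any with p a in pa
  ... | true = a , _ , from T-≡ pa , refl
  ... | false with any
  ...   | here  Ta   = ⊥-elim (subst T pa Ta)
  ...   | there any′ = γscan-head (v ++ [ a ]) w any′

  -- If the first letter a failed p, the output would begin with a later letter satisfying p.
  γscan-fixed⇒all : ∀ d w → T (p (lastOr d w)) → γscan p [] w ≡ w → All (T ∘ p) w
  γscan-fixed⇒all d []      _    _     = []
  γscan-fixed⇒all d (a ∷ w) last fixed with p a in pa
  ... | true  = from T-≡ pa ∷ γscan-fixed⇒all a w last (∷-injectiveʳ fixed)
  ... | false with lastOr-any a w last
  ...   | here  Ta  = ⊥-elim (subst T pa Ta)
  ...   | there any with γscan-head [ a ] w any
  ...     | b , _ , Tb , out≡ =
    ⊥-elim (subst T pa (subst (T ∘ p) (∷-injectiveˡ (trans (sym out≡) fixed)) Tb))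

γ-fixed⇔OneSided : ∀ x w → γ x w ≡ w ⇔ OneSided x w
γ-fixed⇔OneSided x []      = mk⇔ (λ _ → inj₁ []) (λ _ → refl)
γ-fixed⇔OneSided x (a ∷ w) with lastOr a w ≤ᵇ x in last≤x
... | true  = mk⇔ below (Sum.[ γscan-all (_≤ᵇ x) (a ∷ w) ∘ All.map ≤⇒≤ᵇ , not-above ])
  where
  below : γscan (_≤ᵇ x) [] (a ∷ w) ≡ a ∷ w → OneSided x (a ∷ w)
  below fixed = inj₁ (All.map (λ {b} → ≤ᵇ⇒≤ b x)
    (γscan-fixed⇒all (_≤ᵇ x) a (a ∷ w) (from T-≡ last≤x) fixed))
  not-above : All (x <_) (a ∷ w) → γscan (_≤ᵇ x) [] (a ∷ w) ≡ a ∷ w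
  not-above >x = ⊥-elim (<⇒≱ (lastOr-all a w >x) (≤ᵇ⇒≤ _ x (from T-≡ last≤x)))
... | false = mk⇔ above (Sum.[ not-below , γscan-all p (a ∷ w) ∘ All.map (from (T-not-≤ᵇ⇔> _ x)) ])
  where
  p = λ b → not (b ≤ᵇ x)
  above : γscan p [] (a ∷ w) ≡ a ∷ w → OneSided x (a ∷ w)
  above fixed = inj₂ (All.map (to (T-not-≤ᵇ⇔> _ x))
    (γscan-fixed⇒all p a (a ∷ w) (from T-not-≡ last≤x) fixed))
  not-below : All (_≤ x) (a ∷ w) → γscan p [] (a ∷ w) ≡ a ∷ w
  not-below ≤x = ⊥-elim (subst T last≤x (≤⇒≤ᵇ (lastOr-all a w ≤x)))

OneSidedPrefixes : List ℕ → Set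
OneSidedPrefixes σ = ∀ u y v → σ ≡ u ++ y ∷ v → OneSided y u

drop-length-++ : ∀ {A : Set} (u v : List A) → drop (length u) (u ++ v) ≡ v
drop-length-++ []      v = refl
drop-length-++ (_ ∷ u) v = drop-length-++ u v

take-length-++ : ∀ {A : Set} (u v : List A) → take (length u) (u ++ v) ≡ u
take-length-++ []      v = refl
take-length-++ (a ∷ u) v = cong (a ∷_) (take-length-++ u v)

φ-split : ∀ u y v → φ (suc (length u)) (u ++ y ∷ v) ≡ γ y u ++ y ∷ v
φ-split u y v with drop (length u) (u ++ y ∷ v) | drop-length-++ u (y ∷ v)
... | _ | refl = cong (λ t → γ y t ++ y ∷ v) (take-length-++ u (y ∷ v))

StrongFoataFixed⇒OneSidedPrefixes : ∀ σ → StrongFoataFixed (length σ) σ → OneSidedPrefixes σ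
StrongFoataFixed⇒OneSidedPrefixes _ fixed u y v refl =
  to (γ-fixed⇔OneSided y u)
     (++-cancelʳ (y ∷ v) (γ y u) u
        (trans (sym (φ-split u y v)) (fixed (suc (length u)) (s≤s z≤n) k≤n)))
  where
  k≤n : suc (length u) ≤ length (u ++ y ∷ v)
  k≤n = subst (suc (length u) ≤_) (sym (length-++ u)) (m<m+n (length u) z<s)

OneSidedPrefixes⇒StrongFoataFixed : ∀ n σ → OneSidedPrefixes σ → StrongFoataFixed n σ
OneSidedPrefixes⇒StrongFoataFixed n σ prefixes (suc j) _ _ with drop j σ in drop≡
... | []     = refl
... | y ∷ ys = begin
  γ y (take j σ) ++ y ∷ ys  ≡⟨ cong (_++ y ∷ ys) (from (γ-fixed⇔OneSided y _) (prefixes _ y ys split)) ⟩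
  take j σ ++ y ∷ ys        ≡⟨ split ⟨
  σ                         ∎
  where
  open ≡-Reasoning
  split : σ ≡ take j σ ++ y ∷ ys
  split = trans (sym (take++drop≡id j σ)) (cong (take j σ ++_) drop≡)

OneSidedPrefixes⇔StrongFoataFixed : ∀ σ → OneSidedPrefixes σ ⇔ StrongFoataFixed (length σ) σ
OneSidedPrefixes⇔StrongFoataFixed σ =
  mk⇔ (OneSidedPrefixes⇒StrongFoataFixed (length σ) σ) (StrongFoataFixed⇒OneSidedPrefixes σ)

-- Stated on ρ = reverse σ, the form in which Hrev consumes a permutation.
Stratified : List ℕ → Set
Stratified []      = ⊤
Stratified (y ∷ r) = OneSided y r × Stratified r

Stratified-map-suc : ∀ r → Stratified r ⇔ Stratified (map suc r)
Stratified-map-suc []      = mk⇔ (λ _ → tt) (λ _ → tt)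
Stratified-map-suc (y ∷ r) = mk⇔
  (λ (oneSided , strat) → OneSided-map-suc oneSided , to (Stratified-map-suc r) strat)
  (λ (oneSided , strat) → OneSided-map-suc⁻ oneSided , from (Stratified-map-suc r) strat)
  where
  OneSided-map-suc : OneSided y r → OneSided (suc y) (map suc r)
  OneSided-map-suc = Sum.map (All.map⁺ ∘ All.map s≤s) (All.map⁺ ∘ All.map s≤s)
  OneSided-map-suc⁻ : OneSided (suc y) (map suc r) → OneSided y r
  OneSided-map-suc⁻ = Sum.map (All.map ≤-pred ∘ All.map⁻) (All.map ≤-pred ∘ All.map⁻)

Stratified-∷⇔ : ∀ {y r} → OneSided y r → Stratified r ⇔ Stratified (y ∷ r)
Stratified-∷⇔ oneSided = mk⇔ (oneSided ,_) proj₂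

Stratified⇒OneSided : ∀ ρ → Stratified ρ → ∀ v y u → ρ ≡ v ++ y ∷ u → OneSided y u
Stratified⇒OneSided (_ ∷ _) (oneSided , _) []      _ _ refl = oneSided
Stratified⇒OneSided (_ ∷ r) (_ , strat)    (_ ∷ v) y u ρ≡   =
  Stratified⇒OneSided r strat v y u (∷-injectiveʳ ρ≡)

OneSided⇒Stratified : ∀ ρ → (∀ v y u → ρ ≡ v ++ y ∷ u → OneSided y u) → Stratified ρ
OneSided⇒Stratified []      _        = tt
OneSided⇒Stratified (x ∷ r) oneSided =
  oneSided [] x r refl , OneSided⇒Stratified r (λ v y u r≡ → oneSided (x ∷ v) y u (cong (x ∷_) r≡))

reverse-split : ∀ {A : Set} (u : List A) y v → reverse (u ++ y ∷ v) ≡ reverse v ++ y ∷ reverse u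
reverse-split u y v = begin
  reverse (u ++ y ∷ v)             ≡⟨ reverse-++ u (y ∷ v) ⟩
  reverse (y ∷ v) ++ reverse u     ≡⟨ cong (_++ reverse u) (unfold-reverse y v) ⟩
  (reverse v ++ [ y ]) ++ reverse u ≡⟨ ++-assoc (reverse v) [ y ] (reverse u) ⟩
  reverse v ++ y ∷ reverse u       ∎
  where open ≡-Reasoning

Stratified-reverse⇔OneSidedPrefixes : ∀ σ → Stratified (reverse σ) ⇔ OneSidedPrefixes σ
Stratified-reverse⇔OneSidedPrefixes σ = mk⇔
  (λ strat u y v σ≡ → OneSided-resp-↭ (↭-reverse u)
     (Stratified⇒OneSided (reverse σ) strat (reverse v) y (reverse u)
        (trans (cong reverse σ≡) (reverse-split u y v))))
  (λ prefixes → OneSided⇒Stratified (reverse σ) λ v y u ρ≡ →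
     OneSided-resp-↭ (↭-reverse u) (prefixes (reverse u) y (reverse v)
        (trans (sym (reverse-involutive σ)) (trans (cong reverse ρ≡) (reverse-split v y u)))))

<ᵇ-true : ∀ {s x} → s < x → (s <ᵇ x) ≡ true
<ᵇ-true {zero}  (s≤s _)  = refl
<ᵇ-true {suc s} (s≤s lt) = <ᵇ-true lt

<ᵇ-false : ∀ {s x} → x ≤ s → (s <ᵇ x) ≡ false
<ᵇ-false z≤n      = refl
<ᵇ-false (s≤s le) = <ᵇ-false le

Cup-< : ∀ n {x s} → s < x → Cup n x s ≡ s + n ∸ x
Cup-< n lt rewrite <ᵇ-true lt = refl

Cup-≥ : ∀ n {x s} → x ≤ s → Cup n x s ≡ s ∸ x
Cup-≥ n le rewrite <ᵇ-false le = refl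

Cdown-< : ∀ {x s} → s < x → Cdown x s ≡ s
Cdown-< lt rewrite <ᵇ-true lt = refl

Cdown-≥ : ∀ {x s} → x ≤ s → Cdown x s ≡ s ∸ 1
Cdown-≥ le rewrite <ᵇ-false le = refl

CdownInv-< : ∀ {x t} → t < x → CdownInv x t ≡ t
CdownInv-< lt rewrite <ᵇ-true lt = refl

CdownInv-≥ : ∀ {x t} → x ≤ t → CdownInv x t ≡ suc t
CdownInv-≥ le rewrite <ᵇ-false le = refl

Cdown-CdownInv : ∀ x t → Cdown x (CdownInv x t) ≡ t
Cdown-CdownInv x t with <-≤-connex t x
... | inj₁ t<x rewrite CdownInv-< t<x = Cdown-< t<x
... | inj₂ x≤t rewrite CdownInv-≥ x≤t = Cdown-≥ (m≤n⇒m≤1+n x≤t)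

CdownInv-injective : ∀ x → Injective _≡_ _≡_ (CdownInv x)
CdownInv-injective x {s} {t} eq = begin
  s                        ≡⟨ Cdown-CdownInv x s ⟨
  Cdown x (CdownInv x s)   ≡⟨ cong (Cdown x) eq ⟩
  Cdown x (CdownInv x t)   ≡⟨ Cdown-CdownInv x t ⟩
  t                        ∎
  where open ≡-Reasoning

CdownInv-inflationary : ∀ x t → t ≤ CdownInv x t
CdownInv-inflationary x t with <-≤-connex t x
... | inj₁ t<x = ≤-reflexive (sym (CdownInv-< t<x))
... | inj₂ x≤t = ≤-trans (n≤1+n t) (≤-reflexive (sym (CdownInv-≥ x≤t)))

CdownInv-≤-suc : ∀ x t → CdownInv x t ≤ suc t
CdownInv-≤-suc x t with <-≤-connex t x
... | inj₁ t<x = ≤-trans (≤-reflexive (CdownInv-< t<x)) (n≤1+n t)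
... | inj₂ x≤t = ≤-reflexive (CdownInv-≥ x≤t)

-- For 1 < x < n, the round trip through C^x and C_x^{-1} raises letters below x and lowers those above.
CdownInv-Cup-≢ : ∀ n {x} s → 2 ≤ x → x < n → CdownInv x (Cup n x s) ≢ s
CdownInv-Cup-≢ n {x} s 2≤x x<n eq with <-≤-connex s x
... | inj₁ s<x = <-irrefl (sym eq) (begin-strict
  s                         <⟨ m<m+n s (m<n⇒0<n∸m x<n) ⟩
  s + (n ∸ x)               ≡⟨ +-∸-assoc s (<⇒≤ x<n) ⟨
  s + n ∸ x                 ≡⟨ Cup-< n s<x ⟨
  Cup n x s                 ≤⟨ CdownInv-inflationary x (Cup n x s) ⟩
  CdownInv x (Cup n x s)    ∎)
  where open ≤-Reasoning
... | inj₂ x≤s = <-irrefl eq (begin-strict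
  CdownInv x (Cup n x s)    ≡⟨ cong (CdownInv x) (Cup-≥ n x≤s) ⟩
  CdownInv x (s ∸ x)        ≤⟨ CdownInv-≤-suc x (s ∸ x) ⟩
  suc (s ∸ x)               <⟨ +-monoˡ-≤ (s ∸ x) 2≤x ⟩
  x + (s ∸ x)               ≡⟨ m+[n∸m]≡n x≤s ⟩
  s                         ∎)
  where open ≤-Reasoning

range-suc : ∀ m → range (suc m) ≡ 1 ∷ map suc (range m)
range-suc m = cong (λ z → 1 ∷ map suc z) (sym (map-upTo suc m))

range-∷ʳ : ∀ m → range (suc m) ≡ range m ++ [ suc m ]
range-∷ʳ m = trans (cong (map suc) (sym (upTo-∷ʳ m))) (map-++ suc (upTo m) [ m ])

∈-range⁻ : ∀ {n s} → s ∈ range n → 1 ≤ s × s ≤ n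
∈-range⁻ s∈ with ∈-map⁻ suc s∈
... | _ , t∈ , refl = s≤s z≤n , ∈-upTo⁻ t∈

↭-range⇒All : ∀ {n ρ} → ρ ↭ range n → All (λ s → 1 ≤ s × s ≤ n) ρ
↭-range⇒All ρ↭ = All.tabulate (λ s∈ → ∈-range⁻ (∈-resp-↭ ρ↭ s∈))

↭-range⇒length : ∀ {n ρ} → ρ ↭ range n → length ρ ≡ n
↭-range⇒length {n} ρ↭ = trans (↭-length ρ↭) (trans (length-map suc (upTo n)) (length-upTo n))

↭-range-drop-first : ∀ {m r} → 1 ∷ r ↭ range (suc m) → r ↭ map suc (range m)
↭-range-drop-first {m} {r} p = drop-∷ (subst (1 ∷ r ↭_) (range-suc m) p)

↭-range-drop-max : ∀ {m r} → suc m ∷ r ↭ range (suc m) → r ↭ range m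
↭-range-drop-max {m} {r} p =
  drop-∷ (↭-trans (subst (suc m ∷ r ↭_) (range-∷ʳ m) p) (++-comm (range m) [ suc m ]))

endpoint-or-interior : ∀ {m x} → 1 ≤ x × x ≤ suc m → x ≡ 1 ⊎ x ≡ suc m ⊎ (2 ≤ x × x ≤ m)
endpoint-or-interior {x = suc zero}    _ = inj₁ refl
endpoint-or-interior {m} {suc (suc x)} (_ , x≤1+m) with suc (suc x) ≟ suc m
... | yes x≡1+m = inj₂ (inj₁ x≡1+m)
... | no  x≢1+m = inj₂ (inj₂ (s≤s (s≤s z≤n) , ≤-pred (≤∧≢⇒< x≤1+m x≢1+m)))

Hrev-∷-fixed⇔ : ∀ m x r r′ → map (Cup (suc (length r)) x) r ≡ r′ → map (CdownInv x) r′ ≡ r →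
  Hrev (suc m) (x ∷ r) ≡ x ∷ r ⇔ Hrev m r′ ≡ r′
Hrev-∷-fixed⇔ m x r _ refl back = mk⇔
  (λ fixed → map-injective (CdownInv-injective x) (trans (∷-injectiveʳ fixed) (sym back)))
  (λ fixed → cong (x ∷_) (trans (cong (map (CdownInv x)) fixed) back))

Hrev-fixed⇔Stratified-1∷ : ∀ m r → All (1 ≤_) r → (Hrev m r ≡ r ⇔ Stratified r) →
  Hrev (suc m) (1 ∷ map suc r) ≡ 1 ∷ map suc r ⇔ Stratified (1 ∷ map suc r)
Hrev-fixed⇔Stratified-1∷ m r positive ih = begin
  Hrev (suc m) (1 ∷ map suc r) ≡ 1 ∷ map suc r  ∼⟨ Hrev-∷-fixed⇔ m 1 (map suc r) r shift back ⟩
  Hrev m r ≡ r                                   ∼⟨ ih ⟩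
  Stratified r                                   ∼⟨ Stratified-map-suc r ⟩
  Stratified (map suc r)                         ∼⟨ Stratified-∷⇔ (inj₂ (All.map⁺ (All.map s≤s positive))) ⟩
  Stratified (1 ∷ map suc r)                     ∎
  where
  open EquationalReasoning
  shift : map (Cup (suc (length (map suc r))) 1) (map suc r) ≡ r
  shift = trans (sym (map-∘ r)) (map-id r)
  back : map (CdownInv 1) r ≡ map suc r
  back = map-cong-local (All.map CdownInv-≥ positive)

Hrev-fixed⇔Stratified-max∷ : ∀ m r → length r ≡ m → All (_≤ m) r → (Hrev m r ≡ r ⇔ Stratified r) →
  Hrev (suc m) (suc m ∷ r) ≡ suc m ∷ r ⇔ Stratified (suc m ∷ r)
Hrev-fixed⇔Stratified-max∷ m r refl below ih = begin
  Hrev (suc m) (suc m ∷ r) ≡ suc m ∷ r  ∼⟨ Hrev-∷-fixed⇔ m (suc m) r r shift back ⟩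
  Hrev m r ≡ r                           ∼⟨ ih ⟩
  Stratified r                           ∼⟨ Stratified-∷⇔ (inj₁ (All.map m≤n⇒m≤1+n below)) ⟩
  Stratified (suc m ∷ r)                 ∎
  where
  open EquationalReasoning
  shift : map (Cup (suc m) (suc m)) r ≡ r
  shift = map-id-local (All.map (λ {s} s≤m → trans (Cup-< (suc m) (s≤s s≤m)) (m+n∸n≡m s (suc m))) below)
  back : map (CdownInv (suc m)) r ≡ r
  back = map-id-local (All.map (CdownInv-< ∘ s≤s) below)

Hrev-interior-not-fixed : ∀ {m x} r → length r ≡ m → 2 ≤ x → x ≤ m → Hrev (suc m) (x ∷ r) ≢ x ∷ r
Hrev-interior-not-fixed []      refl (s≤s _) ()
Hrev-interior-not-fixed (s ∷ r) refl 2≤x x≤m fixed =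
  CdownInv-Cup-≢ _ s 2≤x (s≤s x≤m) (∷-injectiveˡ (∷-injectiveʳ fixed))

-- r contains both 1 and m + 1, which lie on opposite sides of x.
interior-¬OneSided : ∀ {m x r} → 2 ≤ x → x ≤ m → x ∷ r ↭ range (suc m) → ¬ OneSided x r
interior-¬OneSided {m} 2≤x x≤m p (inj₁ ≤x) with ∈-resp-↭ (↭-sym p) (∈-map⁺ suc (∈-upTo⁺ (n<1+n m)))
... | here  1+m≡x = <-irrefl refl (≤-trans (≤-reflexive 1+m≡x) x≤m)
... | there 1+m∈r = <-irrefl refl (≤-trans (All.lookup ≤x 1+m∈r) x≤m)
interior-¬OneSided 2≤x x≤m p (inj₂ >x) with ∈-resp-↭ (↭-sym p) (here refl)
... | here  1≡x = <-irrefl 1≡x 2≤x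
... | there 1∈r = <-irrefl refl (<-trans (All.lookup >x 1∈r) 2≤x)

Hrev-fixed⇔Stratified : ∀ m ρ → ρ ↭ range m → Hrev m ρ ≡ ρ ⇔ Stratified ρ
Hrev-fixed⇔Stratified zero ρ p with refl ← ↭-empty-inv p = mk⇔ (λ _ → tt) (λ _ → refl)
Hrev-fixed⇔Stratified (suc m) [] p = contradiction (↭-sym p) ¬x∷xs↭[]
Hrev-fixed⇔Stratified (suc m) (x ∷ r) p with endpoint-or-interior (All.head (↭-range⇒All p))
... | inj₁ refl with _ , refl , r′↭ ← ↭-map-inv suc (↭-sym (↭-range-drop-first p)) =
  Hrev-fixed⇔Stratified-1∷ m _ (All.map proj₁ (↭-range⇒All (↭-sym r′↭)))
    (Hrev-fixed⇔Stratified m _ (↭-sym r′↭))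
... | inj₂ (inj₁ refl) =
  Hrev-fixed⇔Stratified-max∷ m r (↭-range⇒length r↭) (All.map proj₂ (↭-range⇒All r↭))
    (Hrev-fixed⇔Stratified m r r↭)
  where r↭ = ↭-range-drop-max p
... | inj₂ (inj₂ (2≤x , x≤m)) = mk⇔
  (⊥-elim ∘ Hrev-interior-not-fixed r (suc-injective (↭-range⇒length p)) 2≤x x≤m)
  (⊥-elim ∘ interior-¬OneSided 2≤x x≤m p ∘ proj₁)

reverse-≡⇔ : ∀ {A : Set} (u v : List A) → reverse u ≡ v ⇔ u ≡ reverse v
reverse-≡⇔ u v = mk⇔
  (λ eq → trans (sym (reverse-involutive u)) (cong reverse eq))
  (λ eq → trans (cong reverse eq) (reverse-involutive v))

theorem3p1 : (n : ℕ) → 1 ≤ n → (σ : List ℕ) → IsPerm n σ →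
    (H σ ≡ σ) ⇔ StrongFoataFixed n σ
theorem3p1 _ _ σ p with refl ← ↭-range⇒length p = begin
  H σ ≡ σ                                  ∼⟨ reverse-≡⇔ (Hrev (length σ) (reverse σ)) σ ⟩
  Hrev (length σ) (reverse σ) ≡ reverse σ  ∼⟨ Hrev-fixed⇔Stratified (length σ) (reverse σ) (↭-trans (↭-reverse σ) p) ⟩
  Stratified (reverse σ)                   ∼⟨ Stratified-reverse⇔OneSidedPrefixes σ ⟩
  OneSidedPrefixes σ                       ∼⟨ OneSidedPrefixes⇔StrongFoataFixed σ ⟩
  StrongFoataFixed (length σ) σ            ∎
  where open EquationalReasoning
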